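{- Let $G$ be a graph and $k\ge \chi_\ell^\bullet(G)$ an integer. Then: (a) for any $k$-list-assignment $L$ of $G$, any $v\in V(G)$ and any $x\in L(v)$, there is a proper $L$-colouring $c$ of $G$ with $c(v)=x$; (b) for any $k$-fold list-cover $H$ of $G$ and any fractional colouring of $H$ of total weight $k$, the fractional colouring assigns positive weight only to maximum independent sets of $H$, and these have size $|V(G)|$. The analogous statements hold with $\chi_c^\bullet(G)$ in place of $\chi_\ell^\bullet(G)$ and $k$-fold correspondence-covers in place of list-covers (where in (a) the conclusion reads: for any $k$-fold correspondence-cover $(L,H)$, any $v$ and any $x\in L(v)$, there is an independent set of $H$ of size $|V(G)|$ containing $x$).
   Context: A correspondence-cover of a graph $G$ is a pair $(L,H)$ where $H$ is a graph and $L:V(G)\to 2^{V(H)}$ is such that: the sets $L(v)$ partition $V(H)$; for distinct non-adjacent $u,v$ there are no edges of $H$ between $L(u)$ and $L(v)$; for $uv\in E(G)$ the edges of $H$ between $L(u)$ and $L(v)$ form a matching; each $L(v)$ induces a clique in $H$. It is $k$-fold if $|L(v)|=k$ for all $v$. A $k$-list-assignment $L$ assigns each vertex a set $L(v)\subseteq\mathbb{N}$ of size $k$; a proper $L$-colouring is a proper colouring $c$ with $c(v)\in L(v)$ for all $v$. The list-cover of $L$ has vertices $x_v$ ($v\in V(G)$, $x\in L(v)$), cliques on each $\{x_v:x\in L(v)\}$, and edges $x_ux_v$ for each $uv\in E(G)$ and $x\in L(u)\cap L(v)$; a $k$-fold list-cover is the list-cover of a $k$-list-assignment. A fractional colouring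 of a graph $H$ of weight $k$ is an assignment of nonnegative weights to independent sets of $H$, with total weight $k$, such that each vertex lies in independent sets of total weight at least $1$. $\chi_\ell^\bullet(G)$ (resp. $\chi_c^\bullet(G)$) is the least integer $k$ such that every $k$-fold list-cover (resp. correspondence-cover) $H$ of $G$ has fractional chromatic number $k$.
   Formalization: The weights of fractional colourings, both those defining fractional chromatic number and those quantified over in part (b), are taken in the rationals. -}

module Defs where

open import Level using (0ℓ)
open import Data.Nat as ℕ using (ℕ; zero; suc)
open import Data.Fin using (Fin)
open import Data.Fin.Properties as FinP using ()
open import Data.Integer using (+_)
open import Data.Rational as ℚ using (ℚ; 0ℚ; 1ℚ)
open import Data.Product using (Σ; ∃; ∃-syntax; _×_; _,_; proj₁; proj₂)
open import Data.Product.Properties using (≡-dec)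
open import Data.Sum using (_⊎_)
open import Data.List using (List; []; _∷_; length)
open import Data.List.Relation.Unary.All using (All)
open import Data.List.Relation.Unary.Unique.Propositional using (Unique)
open import Data.List.Membership.Propositional using (_∈_)
import Data.List.Membership.DecPropositional
import Relation.Nullary
open import Relation.Nullary using (¬_; yes; no)
open import Relation.Binary.PropositionalEquality using (_≡_; _≢_)
open import Function.Definitions using (Injective)

record Graph (V : Set) : Set₁ where
  field
    Adj    : V → V → Set
    sym    : ∀ {u v} → Adj u v → Adj v u
    irrefl : ∀ {u} → ¬ Adj u u
open Graph public

IsIndependent : ∀ {V} → Graph V → List V → Set
IsIndependent H S =
  Unique S × (∀ {x y} → x ∈ S → y ∈ S → ¬ Adj H x y)

IsMaximumIndependent : ∀ {V} → Graph V → List V → Set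
IsMaximumIndependent H S =
  IsIndependent H S × (∀ T → IsIndependent H T → length T ℕ.≤ length S)

-- Vertex set of a k-fold cover of a graph on Fin n: the vertex (v , i)
-- is the i-th element of L(v).  So L(v) = {v} × Fin k.

CoverVertex : ℕ → ℕ → Set
CoverVertex n k = Fin n × Fin k

_≟CV_ : ∀ {n k} (a b : CoverVertex n k) → Relation.Nullary.Dec (a ≡ b)
_≟CV_ = ≡-dec FinP._≟_ FinP._≟_

WeightedSet : ℕ → ℕ → Set
WeightedSet n k = List (CoverVertex n k) × ℚ

totalWeight : ∀ {n k} → List (WeightedSet n k) → ℚ
totalWeight []            = 0ℚ
totalWeight ((_ , w) ∷ f) = w ℚ.+ totalWeight f


coverage : ∀ {n k} → List (WeightedSet n k) → CoverVertex n k → ℚ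
coverage []            x = 0ℚ
coverage {n} {k} ((S , w) ∷ f) x with Data.List.Membership.DecPropositional._∈?_ (_≟CV_ {n} {k}) x S
... | yes _ = w ℚ.+ coverage f x
... | no  _ = coverage f x

IsFractionalColouring : ∀ {n k} → Graph (CoverVertex n k) → List (WeightedSet n k) → Set
IsFractionalColouring H f =
  All (λ { (S , w) → IsIndependent H S × 0ℚ ℚ.≤ w }) f ×
  (∀ x → 1ℚ ℚ.≤ coverage f x)

ℕtoℚ : ℕ → ℚ
ℕtoℚ m = + m ℚ./ 1

HasFracChromNum : ∀ {n k} → Graph (CoverVertex n k) → ℕ → Set
HasFracChromNum H m =
  (∃[ f ] (IsFractionalColouring H f × totalWeight f ≡ ℕtoℚ m)) ×
  (∀ f → IsFractionalColouring H f → ℕtoℚ m ℚ.≤ totalWeight f)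

record ListAssignment {n} (G : Graph (Fin n)) (k : ℕ) : Set where
  field
    colour   : Fin n → Fin k → ℕ
    distinct : ∀ v → Injective _≡_ _≡_ (colour v)
open ListAssignment public

ListCover : ∀ {n} {G : Graph (Fin n)} {k} → ListAssignment G k → Graph (CoverVertex n k)
ListCover {n} {G} {k} L = record
  { Adj    = A
  ; sym    = symA
  ; irrefl = irreflA
  }
  where
  A : CoverVertex n k → CoverVertex n k → Set
  A (u , i) (v , j) = (u ≡ v × i ≢ j) ⊎ (Adj G u v × colour L u i ≡ colour L v j)
  open import Relation.Binary.PropositionalEquality using (refl)
  open import Data.Sum using (inj₁; inj₂)
  symA : ∀ {a b} → A a b → A b a
  symA (inj₁ (refl , i≢j)) = inj₁ (refl , λ { refl → i≢j refl })
  symA (inj₂ (e , c))      = inj₂ (sym G e , Relation.Binary.PropositionalEquality.sym c)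
  irreflA : ∀ {a} → ¬ A a a
  irreflA (inj₁ (_ , i≢i)) = i≢i refl
  irreflA (inj₂ (e , _))   = irrefl G e

IsProperLColouring : ∀ {n} {G : Graph (Fin n)} {k} → ListAssignment G k → (Fin n → ℕ) → Set
IsProperLColouring {n} {G} L c =
  (∀ v → ∃[ i ] colour L v i ≡ c v) ×
  (∀ {u v} → Adj G u v → c u ≢ c v)

record CorrespondenceCover {n} (G : Graph (Fin n)) (k : ℕ) : Set₁ where
  field
    H        : Graph (CoverVertex n k)
    clique   : ∀ v {i j} → i ≢ j → Adj H (v , i) (v , j)
    nonadj   : ∀ {u v} i j → u ≢ v → ¬ Adj G u v → ¬ Adj H (u , i) (v , j)
    matching : ∀ {u v} i {j j′} → u ≢ v → Adj G u v →
               Adj H (u , i) (v , j) → Adj H (u , i) (v , j′) → j ≡ j′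
open CorrespondenceCover public

-- χ_ℓ^•(G) ≤ k  and  χ_c^•(G) ≤ k  (chromatic numbers range over
-- positive integers).

ListBulletProperty : ∀ {n} → Graph (Fin n) → ℕ → Set
ListBulletProperty G m = ∀ (L : ListAssignment G m) → HasFracChromNum (ListCover L) m

CorrBulletProperty : ∀ {n} → Graph (Fin n) → ℕ → Set₁
CorrBulletProperty G m = ∀ (C : CorrespondenceCover G m) → HasFracChromNum (H C) m

χℓ•≤ : ∀ {n} → Graph (Fin n) → ℕ → Set
χℓ•≤ G k = Σ ℕ λ m → 1 ℕ.≤ m × m ℕ.≤ k × ListBulletProperty G m

χc•≤ : ∀ {n} → Graph (Fin n) → ℕ → Set₁
χc•≤ G k = Σ ℕ λ m → 1 ℕ.≤ m × m ℕ.≤ k × CorrBulletProperty G m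

TightFractionalColourings : ∀ {n k} → Graph (CoverVertex n k) → Set
TightFractionalColourings {n} {k} H =
  ∀ f → IsFractionalColouring H f → totalWeight f ≡ ℕtoℚ k →
  All (λ { (S , w) → 0ℚ ℚ.< w → IsMaximumIndependent H S × length S ≡ n }) f

ListConclusion : ∀ {n} → Graph (Fin n) → ℕ → Set
ListConclusion {n} G k =
  (∀ (L : ListAssignment G k) (v : Fin n) (i : Fin k) →
     ∃[ c ] (IsProperLColouring L c × c v ≡ colour L v i)) ×
  (∀ (L : ListAssignment G k) → TightFractionalColourings (ListCover L))

CorrConclusion : ∀ {n} → Graph (Fin n) → ℕ → Set₁
CorrConclusion {n} G k =
  (∀ (C : CorrespondenceCover G k) (v : Fin n) (i : Fin k) →
     ∃[ S ] (IsIndependent (H C) S × length S ≡ n × (v , i) ∈ S)) ×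
  (∀ (C : CorrespondenceCover G k) → TightFractionalColourings (H C))

-- In a k-fold cover each fibre L(u) is a k-clique, so an independent set meets it at most
-- once. Summing coverage ≥ 1 over the k vertices of L(u) shows that the sets meeting L(u)
-- carry weight at least k; so if the total weight is k, every set of positive weight meets
-- every fibre, i.e. is an independent transversal, of size |V(G)| and hence maximum. This
-- gives (b). For (a), place x in an m-fold subcover, where m ≤ k has the bullet property: a
-- set of positive weight through x in its weight-m fractional colouring is an independent
-- transversal, which is the required independent set (for list-covers, the L-colouring).
module Submission where

open import Defs hiding (sym)
open import Data.Nat as ℕ using (ℕ; zero; suc)
import Data.Nat.Properties as ℕP
import Data.Nat.Coprimality as Coprime
open import Data.Fin using (Fin; zero; suc; inject≤; fromℕ<; punchIn)
import Data.Fin.Properties as FinP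
import Data.Fin.Permutation.Components as PermC
open import Data.Integer using (+_)
open import Data.Rational as ℚ using (ℚ; 0ℚ; 1ℚ)
import Data.Rational.Properties as ℚP
open import Algebra.Properties.CommutativeMonoid.Sum ℚP.+-0-commutativeMonoid
  using (sum; sum-remove; sum-cong-≗; sum-replicate-zero; ∑-distrib-+)
open import Data.Product as Prod using (∃; ∃-syntax; _×_; _,_; proj₁; proj₂)
open import Data.Sum using (inj₁; inj₂)
open import Data.List using (List; []; _∷_; length; lookup; map; filter)
open import Data.List.Relation.Unary.All as All using (All; []; _∷_)
open import Data.List.Relation.Unary.Any as Any using (here; there)
open import Data.List.Relation.Unary.Any.Properties using (lookup-index)
open import Data.List.Relation.Unary.AllPairs using (_∷_)
open import Data.List.Relation.Unary.Unique.Propositional using (Unique)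
open import Data.List.Relation.Unary.Unique.Propositional.Properties using (map⁺)
open import Data.List.Membership.Propositional using (_∈_)
open import Data.List.Membership.Propositional.Properties using (∈-lookup; ∈-map⁺; ∈-map⁻)
open import Data.Empty using (⊥-elim)
open import Relation.Nullary using (¬_; Dec; yes; no; contradiction)
open import Relation.Unary using (Pred; Decidable)
open import Relation.Binary.PropositionalEquality
open import Function using (_∘_)
open import Function.Definitions using (Injective)

ℕtoℚ-suc : ∀ k → ℕtoℚ (suc k) ≡ 1ℚ ℚ.+ ℕtoℚ k
ℕtoℚ-suc zero    = refl
ℕtoℚ-suc (suc k) = sym (begin
  1ℚ ℚ.+ ℕtoℚ (suc k)        ≡⟨ cong (1ℚ ℚ.+_) (ℚP.normalize-coprime (Coprime.sym (Coprime.1-coprimeTo (suc k)))) ⟩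
  + suc (suc k ℕ.* 1) ℚ./ 1  ≡⟨ cong (λ m → + suc m ℚ./ 1) (ℕP.*-identityʳ (suc k)) ⟩
  ℕtoℚ (suc (suc k))         ∎)
  where open ≡-Reasoning

∑-zero : ∀ {k} (g : Fin k → ℚ) → (∀ j → g j ≡ 0ℚ) → sum g ≡ 0ℚ
∑-zero {k} g g≡0 = trans (sum-cong-≗ g≡0) (sum-replicate-zero k)

∑-single : ∀ {k} (g : Fin k → ℚ) i → (∀ j → j ≢ i → g j ≡ 0ℚ) → sum g ≡ g i
∑-single {suc k} g i g≡0 = begin
  sum g                                        ≡⟨ sum-remove {i = i} g ⟩
  g i ℚ.+ sum (λ j → g (punchIn i j))          ≡⟨ cong (g i ℚ.+_) (∑-zero _ (λ j → g≡0 _ (FinP.punchInᵢ≢i i j))) ⟩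
  g i ℚ.+ 0ℚ                                   ≡⟨ ℚP.+-identityʳ (g i) ⟩
  g i                                          ∎
  where open ≡-Reasoning

ℕtoℚ≤∑ : ∀ {k} (g : Fin k → ℚ) → (∀ j → 1ℚ ℚ.≤ g j) → ℕtoℚ k ℚ.≤ sum g
ℕtoℚ≤∑ {zero}  g _   = ℚP.≤-refl
ℕtoℚ≤∑ {suc k} g 1≤g = subst (ℚ._≤ sum g) (sym (ℕtoℚ-suc k))
  (ℚP.+-mono-≤ (1≤g zero) (ℕtoℚ≤∑ (g ∘ suc) (1≤g ∘ suc)))

Unique⇒lookup-injective : ∀ {A : Set} {xs : List A} → Unique xs → Injective _≡_ _≡_ (lookup xs)
Unique⇒lookup-injective (_ ∷ _) {zero}  {zero}  _ = refl
Unique⇒lookup-injective (x∉ ∷ _) {zero}  {suc j} eq = ⊥-elim (All.lookup x∉ (∈-lookup j) eq)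
Unique⇒lookup-injective (x∉ ∷ _) {suc i} {zero}  eq = ⊥-elim (All.lookup x∉ (∈-lookup i) (sym eq))
Unique⇒lookup-injective (_ ∷ u) {suc i} {suc j} eq = cong suc (Unique⇒lookup-injective u eq)

transpose-hits : ∀ {n} (a b : Fin n) → PermC.transpose a b a ≡ b
transpose-hits a b with a FinP.≟ a
... | yes _  = refl
... | no a≢a = contradiction refl a≢a

injection-through : ∀ {m k} → m ℕ.≤ k → (j : Fin m) (i : Fin k) →
                    ∃[ e ] (Injective _≡_ _≡_ e × e j ≡ i)
injection-through m≤k j i = e , e-injective , transpose-hits (inject≤ j m≤k) i
  where
  e = λ x → PermC.transpose (inject≤ j m≤k) i (inject≤ x m≤k)
  e-injective : Injective _≡_ _≡_ e
  e-injective {x} {y} ex≡ey = FinP.inject≤-injective m≤k m≤k x y (begin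
    inject≤ x m≤k                                 ≡⟨ PermC.transpose-inverse i (inject≤ j m≤k) ⟨
    PermC.transpose i (inject≤ j m≤k) (e x)       ≡⟨ cong (PermC.transpose i (inject≤ j m≤k)) ex≡ey ⟩
    PermC.transpose i (inject≤ j m≤k) (e y)       ≡⟨ PermC.transpose-inverse i (inject≤ j m≤k) ⟩
    inject≤ y m≤k                                 ∎)
    where open ≡-Reasoning

≤-+-nonnegˡ : ∀ {w q} → 0ℚ ℚ.≤ w → q ℚ.≤ w ℚ.+ q
≤-+-nonnegˡ {w} {q} 0≤w = ℚP.≤-trans (ℚP.≤-reflexive (sym (ℚP.+-identityˡ q))) (ℚP.+-monoˡ-≤ q 0≤w)

module _ {n k : ℕ} {ℓ} {P : Pred (WeightedSet n k) ℓ} (P? : Decidable P) where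

  totalWeight-filter≤ : ∀ {f} → All ((0ℚ ℚ.≤_) ∘ proj₂) f → totalWeight (filter P? f) ℚ.≤ totalWeight f
  totalWeight-filter≤ {[]}          []          = ℚP.≤-refl
  totalWeight-filter≤ {(S , w) ∷ f} (0≤w ∷ f≥0) with P? (S , w)
  ... | yes _ = ℚP.+-monoʳ-≤ w (totalWeight-filter≤ f≥0)
  ... | no _  = ℚP.≤-trans (totalWeight-filter≤ f≥0) (≤-+-nonnegˡ 0≤w)

  totalWeight-filter+excluded≤ : ∀ {f s} → All ((0ℚ ℚ.≤_) ∘ proj₂) f → s ∈ f → ¬ P s →
                                 totalWeight (filter P? f) ℚ.+ proj₂ s ℚ.≤ totalWeight f
  totalWeight-filter+excluded≤ {(S , w) ∷ f} (_ ∷ f≥0) (here refl) ¬Ps with P? (S , w)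
  ... | yes Ps = contradiction Ps ¬Ps
  ... | no _   = ℚP.≤-trans (ℚP.≤-reflexive (ℚP.+-comm _ w)) (ℚP.+-monoʳ-≤ w (totalWeight-filter≤ f≥0))
  totalWeight-filter+excluded≤ {(S , w) ∷ f} {s} (0≤w ∷ f≥0) (there s∈f) ¬Ps with P? (S , w)
  ... | yes _ = ℚP.≤-trans (ℚP.≤-reflexive (ℚP.+-assoc w _ (proj₂ s)))
                  (ℚP.+-monoʳ-≤ w (totalWeight-filter+excluded≤ f≥0 s∈f ¬Ps))
  ... | no _  = ℚP.≤-trans (totalWeight-filter+excluded≤ f≥0 s∈f ¬Ps) (≤-+-nonnegˡ 0≤w)

comap : ∀ {A B : Set} → (A → B) → Graph B → Graph A
comap f H = record { Adj = λ a b → Adj H (f a) (f b) ; sym = Graph.sym H ; irrefl = irrefl H }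

module _ {n k : ℕ} where

  open import Data.List.Membership.DecPropositional (_≟CV_ {n} {k}) using (_∈?_)

  FibresAreCliques : Graph (CoverVertex n k) → Set
  FibresAreCliques H = ∀ u {i j} → i ≢ j → Adj H (u , i) (u , j)

  Meets : List (CoverVertex n k) → Fin n → Set
  Meets S u = ∃[ j ] (u , j) ∈ S

  meets? : ∀ S u → Dec (Meets S u)
  meets? S u = FinP.any? (λ j → (u , j) ∈? S)

  IsTransversal : List (CoverVertex n k) → Set
  IsTransversal S = ∀ u → Meets S u

  transversal-length≥ : ∀ {S} → IsTransversal S → n ℕ.≤ length S
  transversal-length≥ {S} T = FinP.injective⇒≤ {f = Any.index ∘ proj₂ ∘ T} λ {u} {v} eq →
    cong proj₁ (trans (lookup-index (proj₂ (T u)))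
               (trans (cong (lookup S) eq) (sym (lookup-index (proj₂ (T v))))))

  indicator : List (CoverVertex n k) → ℚ → CoverVertex n k → ℚ
  indicator S w x with x ∈? S
  ... | yes _ = w
  ... | no _  = 0ℚ

  coverage-∷ : ∀ S w f x → coverage ((S , w) ∷ f) x ≡ indicator S w x ℚ.+ coverage f x
  coverage-∷ S w f x with x ∈? S
  ... | yes _ = refl
  ... | no _  = sym (ℚP.+-identityˡ _)

  ∑-indicator-misses : ∀ {S w u} → ¬ Meets S u → sum (λ j → indicator S w (u , j)) ≡ 0ℚ
  ∑-indicator-misses {S} {w} {u} misses = ∑-zero {k} _ vanishes
    where
    vanishes : ∀ j → indicator S w (u , j) ≡ 0ℚ
    vanishes j with (u , j) ∈? S
    ... | yes uj∈S = contradiction (j , uj∈S) misses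
    ... | no _     = refl

  weightMeeting : Fin n → List (WeightedSet n k) → ℚ
  weightMeeting u = totalWeight ∘ filter (λ s → meets? (proj₁ s) u)

  coverage-positive⇒∈positive : ∀ f x → 0ℚ ℚ.< coverage f x →
                                ∃[ s ] (s ∈ f × x ∈ proj₁ s × 0ℚ ℚ.< proj₂ s)
  coverage-positive⇒∈positive []            x 0<0 = contradiction 0<0 (ℚP.<-irrefl refl)
  coverage-positive⇒∈positive ((S , w) ∷ f) x 0<c with x ∈? S
  ... | no _ = Prod.map₂ (Prod.map₁ there) (coverage-positive⇒∈positive f x 0<c)
  ... | yes x∈S with 0ℚ ℚ.<? w
  ...   | yes 0<w = (S , w) , here refl , x∈S , 0<w
  ...   | no 0≮w  = Prod.map₂ (Prod.map₁ there) (coverage-positive⇒∈positive f x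
                      (ℚP.<-≤-trans 0<c (ℚP.≤-trans (ℚP.+-monoˡ-≤ _ (ℚP.≮⇒≥ 0≮w))
                                                     (ℚP.≤-reflexive (ℚP.+-identityˡ _)))))

module FibreCliques {n k : ℕ} (H : Graph (CoverVertex n k)) (cliques : FibresAreCliques H) where

  independent-fibre-injective : ∀ {S a b} → IsIndependent H S → a ∈ S → b ∈ S →
                                proj₁ a ≡ proj₁ b → a ≡ b
  independent-fibre-injective {a = u , i} {b = .u , j} S-ind a∈S b∈S refl with i FinP.≟ j
  ... | yes refl = refl
  ... | no i≢j   = ⊥-elim (proj₂ S-ind a∈S b∈S (cliques u i≢j))

  independent-length≤ : ∀ {S} → IsIndependent H S → length S ℕ.≤ n
  independent-length≤ {S} S-ind = FinP.injective⇒≤ {f = proj₁ ∘ lookup S} λ {i} {j} eq →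
    Unique⇒lookup-injective (proj₁ S-ind)
      (independent-fibre-injective S-ind (∈-lookup i) (∈-lookup j) eq)

  transversal-length : ∀ {S} → IsIndependent H S → IsTransversal S → length S ≡ n
  transversal-length S-ind T = ℕP.≤-antisym (independent-length≤ S-ind) (transversal-length≥ T)

  transversal-maximum : ∀ {S} → IsIndependent H S → IsTransversal S → IsMaximumIndependent H S
  transversal-maximum S-ind T = S-ind , λ R R-ind →
    ℕP.≤-trans (independent-length≤ R-ind) (ℕP.≤-reflexive (sym (transversal-length S-ind T)))

  open import Data.List.Membership.DecPropositional (_≟CV_ {n} {k}) using (_∈?_)

  ∑-indicator-meets : ∀ {S w u} → IsIndependent H S → Meets S u → sum (λ j → indicator S w (u , j)) ≡ w
  ∑-indicator-meets {S} {w} {u} S-ind (j , uj∈S) = trans (∑-single _ j vanishes) hit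
    where
    vanishes : ∀ i → i ≢ j → indicator S w (u , i) ≡ 0ℚ
    vanishes i i≢j with (u , i) ∈? S
    ... | yes ui∈S = contradiction (cong proj₂ (independent-fibre-injective S-ind ui∈S uj∈S refl)) i≢j
    ... | no _     = refl
    hit : indicator S w (u , j) ≡ w
    hit with (u , j) ∈? S
    ... | yes _    = refl
    ... | no uj∉S  = contradiction uj∈S uj∉S

  ∑-coverage-fibre : ∀ u f → All (IsIndependent H ∘ proj₁) f →
                     sum (λ j → coverage f (u , j)) ≡ weightMeeting u f
  ∑-coverage-fibre u []            []              = ∑-zero {k} _ (λ _ → refl)
  ∑-coverage-fibre u ((S , w) ∷ f) (S-ind ∷ f-ind) = trans split combine
    where
    open ≡-Reasoning
    ∑ind = sum (λ j → indicator S w (u , j))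
    split : sum (λ j → coverage ((S , w) ∷ f) (u , j)) ≡ ∑ind ℚ.+ sum (λ j → coverage f (u , j))
    split = trans (sum-cong-≗ (λ j → coverage-∷ S w f (u , j))) (∑-distrib-+ (λ j → indicator S w (u , j)) (λ j → coverage f (u , j)))
    combine : ∑ind ℚ.+ sum (λ j → coverage f (u , j)) ≡ weightMeeting u ((S , w) ∷ f)
    combine with meets? S u
    ... | yes meets  = cong₂ ℚ._+_ (∑-indicator-meets S-ind meets) (∑-coverage-fibre u f f-ind)
    ... | no misses = begin
      ∑ind ℚ.+ sum (λ j → coverage f (u , j))  ≡⟨ cong₂ ℚ._+_ (∑-indicator-misses misses) (∑-coverage-fibre u f f-ind) ⟩
      0ℚ ℚ.+ weightMeeting u f                 ≡⟨ ℚP.+-identityˡ _ ⟩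
      weightMeeting u f                        ∎

  independents : ∀ {f} → IsFractionalColouring H f → All (IsIndependent H ∘ proj₁) f
  independents = All.map (λ { {S , w} (S-ind , _) → S-ind }) ∘ proj₁

  nonnegative : ∀ {f} → IsFractionalColouring H f → All ((0ℚ ℚ.≤_) ∘ proj₂) f
  nonnegative = All.map (λ { {S , w} (_ , 0≤w) → 0≤w }) ∘ proj₁

  weight-k⇒positive-transversal : ∀ {f} → IsFractionalColouring H f → totalWeight f ≡ ℕtoℚ k →
                                   ∀ {s} → s ∈ f → 0ℚ ℚ.< proj₂ s → IsTransversal (proj₁ s)
  weight-k⇒positive-transversal {f} f-col f≡k {S , w} s∈f 0<w u with meets? S u
  ... | yes meets = meets
  ... | no misses = contradiction (begin-strict
    ℕtoℚ k                                    ≡⟨ ℚP.+-identityʳ (ℕtoℚ k) ⟨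
    ℕtoℚ k ℚ.+ 0ℚ                             <⟨ ℚP.+-monoʳ-< (ℕtoℚ k) 0<w ⟩
    ℕtoℚ k ℚ.+ w                              ≤⟨ ℚP.+-monoˡ-≤ w (ℕtoℚ≤∑ _ (λ j → proj₂ f-col (u , j))) ⟩
    sum (λ j → coverage f (u , j)) ℚ.+ w      ≡⟨ cong (ℚ._+ w) (∑-coverage-fibre u f (independents f-col)) ⟩
    weightMeeting u f ℚ.+ w                   ≤⟨ totalWeight-filter+excluded≤ _ (nonnegative f-col) s∈f misses ⟩
    totalWeight f                             ≡⟨ f≡k ⟩
    ℕtoℚ k                                    ∎) (ℚP.<-irrefl refl)
    where open ℚP.≤-Reasoning

  tight : TightFractionalColourings H
  tight f f-col f≡k = All.tabulate λ { {S , w} s∈f 0<w →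
    let S-ind = All.lookup (independents f-col) s∈f
        S-transversal = weight-k⇒positive-transversal f-col f≡k s∈f 0<w
    in transversal-maximum S-ind S-transversal , transversal-length S-ind S-transversal }

  transversal-through : ∀ {f} → IsFractionalColouring H f → totalWeight f ≡ ℕtoℚ k → ∀ x →
                        ∃[ S ] (IsIndependent H S × IsTransversal S × x ∈ S)
  transversal-through {f} f-col f≡k x
    with coverage-positive⇒∈positive f x (ℚP.<-≤-trans (ℚP.positive⁻¹ 1ℚ) (proj₂ f-col x))
  ... | s , s∈f , x∈S , 0<w =
    proj₁ s , All.lookup (independents f-col) s∈f , weight-k⇒positive-transversal f-col f≡k s∈f 0<w , x∈S

module Restriction {n m k : ℕ} {e : Fin m → Fin k} (e-injective : Injective _≡_ _≡_ e) where

  lift : CoverVertex n m → CoverVertex n k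
  lift (u , j) = u , e j

  lift-injective : Injective _≡_ _≡_ lift
  lift-injective {u , i} {v , j} eq with cong proj₁ eq | e-injective (cong proj₂ eq)
  ... | refl | refl = refl

  map-lift-transversal : ∀ {S} → IsTransversal S → IsTransversal (map lift S)
  map-lift-transversal T u = Prod.map e (∈-map⁺ lift) (T u)

  map-lift-independent : ∀ (H : Graph (CoverVertex n k)) (H′ : Graph (CoverVertex n m)) →
                         (∀ {a b} → Adj H (lift a) (lift b) → Adj H′ a b) →
                         ∀ {S} → IsIndependent H′ S → IsIndependent H (map lift S)
  map-lift-independent H H′ reflects (S-unique , S-ind) = map⁺ lift-injective S-unique , ind
    where
    ind : ∀ {x y} → x ∈ map lift _ → y ∈ map lift _ → ¬ Adj H x y
    ind x∈ y∈ xy with ∈-map⁻ lift x∈ | ∈-map⁻ lift y∈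
    ... | _ , a∈S , refl | _ , b∈S , refl = S-ind a∈S b∈S (reflects xy)

  transversal-through-subcover :
    (H : Graph (CoverVertex n k)) (H′ : Graph (CoverVertex n m)) → FibresAreCliques H′ →
    (∀ {a b} → Adj H (lift a) (lift b) → Adj H′ a b) →
    ∃[ f ] (IsFractionalColouring H′ f × totalWeight f ≡ ℕtoℚ m) →
    ∀ x → ∃[ S ] (IsIndependent H S × IsTransversal S × lift x ∈ S)
  transversal-through-subcover H H′ cliques reflects (f , f-col , f≡m) x
    with FibreCliques.transversal-through H′ cliques f-col f≡m x
  ... | S , S-ind , S-transversal , x∈S =
    map lift S , map-lift-independent H H′ reflects S-ind , map-lift-transversal S-transversal , ∈-map⁺ lift x∈S

module _ {n} {G : Graph (Fin n)} where

  listCover-fibresAreCliques : ∀ {k} (L : ListAssignment G k) → FibresAreCliques (ListCover L)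
  listCover-fibresAreCliques L u i≢j = inj₁ (refl , i≢j)

  restrictListAssignment : ∀ {m k} {e : Fin m → Fin k} → Injective _≡_ _≡_ e →
                           ListAssignment G k → ListAssignment G m
  restrictListAssignment {e = e} e-injective L = record
    { colour   = λ u → colour L u ∘ e
    ; distinct = λ u → e-injective ∘ distinct L u
    }

  restrictCorrespondenceCover : ∀ {m k} {e : Fin m → Fin k} → Injective _≡_ _≡_ e →
                                CorrespondenceCover G k → CorrespondenceCover G m
  restrictCorrespondenceCover {e = e} e-injective C = record
    { H        = comap lift (H C)
    ; clique   = λ u i≢j → clique C u (i≢j ∘ e-injective)
    ; nonadj   = λ i j → nonadj C (e i) (e j)
    ; matching = λ i u≢v uv ij ij′ → e-injective (matching C (e i) u≢v uv ij ij′)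
    }
    where open Restriction e-injective

  transversal⇒LColouring : ∀ {k} (L : ListAssignment G k) {S v i} →
                           IsIndependent (ListCover L) S → IsTransversal S → (v , i) ∈ S →
                           ∃[ c ] (IsProperLColouring L c × c v ≡ colour L v i)
  transversal⇒LColouring L {S} {v} {i} S-ind T vi∈S = c , (in-list , proper) , c-hits
    where
    open FibreCliques (ListCover L) (listCover-fibresAreCliques L)
    c : Fin n → ℕ
    c u = colour L u (proj₁ (T u))
    in-list : ∀ u → ∃[ j ] colour L u j ≡ c u
    in-list u = proj₁ (T u) , refl
    proper : ∀ {u w} → Adj G u w → c u ≢ c w
    proper uw cu≡cw = proj₂ S-ind (proj₂ (T _)) (proj₂ (T _)) (inj₂ (uw , cu≡cw))
    c-hits : c v ≡ colour L v i
    c-hits = cong (colour L v ∘ proj₂) (independent-fibre-injective S-ind (proj₂ (T v)) vi∈S refl)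

  restrictListAssignment-reflects :
    ∀ {m k} {e : Fin m → Fin k} (e-injective : Injective _≡_ _≡_ e) (L : ListAssignment G k) →
    let open Restriction {n} e-injective in
    ∀ {a b} → Adj (ListCover L) (lift a) (lift b) → Adj (ListCover (restrictListAssignment e-injective L)) a b
  restrictListAssignment-reflects {e = e} _ _ (inj₁ (refl , ea≢eb)) = inj₁ (refl , ea≢eb ∘ cong e)
  restrictListAssignment-reflects         _ _ (inj₂ uv)             = inj₂ uv

  listConclusion : ∀ {m k} → 1 ℕ.≤ m → m ℕ.≤ k → ListBulletProperty G m → ListConclusion G k
  listConclusion {m} {k} 1≤m m≤k bullet =
    colouring-through , λ L → FibreCliques.tight (ListCover L) (listCover-fibresAreCliques L)
    where
    colouring-through-lift : ∀ {e : Fin m → Fin k} → Injective _≡_ _≡_ e → ∀ L v j →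
                             ∃[ c ] (IsProperLColouring L c × c v ≡ colour L v (e j))
    colouring-through-lift e-injective L v j =
      let L′ = restrictListAssignment e-injective L
          S , S-ind , S-transversal , vj∈S =
            Restriction.transversal-through-subcover e-injective (ListCover L) (ListCover L′)
              (listCover-fibresAreCliques L′) (restrictListAssignment-reflects e-injective L)
              (proj₁ (bullet L′)) (v , j)
      in transversal⇒LColouring L S-ind S-transversal vj∈S

    colouring-through : ∀ L v i → ∃[ c ] (IsProperLColouring L c × c v ≡ colour L v i)
    colouring-through L v i with injection-through m≤k (fromℕ< 1≤m) i
    ... | _ , e-injective , refl = colouring-through-lift e-injective L v (fromℕ< 1≤m)

  corrConclusion : ∀ {m k} → 1 ℕ.≤ m → m ℕ.≤ k → CorrBulletProperty G m → CorrConclusion G k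
  corrConclusion {m} {k} 1≤m m≤k bullet = independent-through , λ C → FibreCliques.tight (H C) (clique C)
    where
    independent-through-lift : ∀ {e : Fin m → Fin k} → Injective _≡_ _≡_ e → ∀ C v j →
                               ∃[ S ] (IsIndependent (H C) S × length S ≡ n × (v , e j) ∈ S)
    independent-through-lift e-injective C v j =
      let C′ = restrictCorrespondenceCover e-injective C
          S , S-ind , S-transversal , vj∈S =
            Restriction.transversal-through-subcover e-injective (H C) (H C′) (clique C′) (λ xy → xy)
              (proj₁ (bullet C′)) (v , j)
      in S , S-ind , FibreCliques.transversal-length (H C) (clique C) S-ind S-transversal , vj∈S

    independent-through : ∀ C v i → ∃[ S ] (IsIndependent (H C) S × length S ≡ n × (v , i) ∈ S)
    independent-through C v i with injection-through m≤k (fromℕ< 1≤m) i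
    ... | _ , e-injective , refl = independent-through-lift e-injective C v (fromℕ< 1≤m)

proposition11 : ∀ {n} (G : Graph (Fin n)) (k : ℕ) →
    (χℓ•≤ G k → ListConclusion G k) × (χc•≤ G k → CorrConclusion G k)
proposition11 G k =
  (λ { (m , 1≤m , m≤k , bullet) → listConclusion 1≤m m≤k bullet }) ,
  (λ { (m , 1≤m , m≤k , bullet) → corrConclusion 1≤m m≤k bullet })
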